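{- Let $n\geq 1$, let $U_{6n}=\langle a,b\mid a^{2n}=b^3=1,\ a^{ -1}ba=b^{ -1}\rangle$, and let $\Gamma=\Gamma(U_{6n})$ be its non-commuting graph. Then the resolving polynomial of $\Gamma$ is $$\beta(\Gamma,x)=\begin{cases}x^3(x+2)(x+3) & \text{if } n=1,\\ x^{5n-4}(x+n)^3(x+2n) & \text{if } n>1.\end{cases}$$
   Context: The group $U_{6n}$ has order $6n$ and center $Z(U_{6n})=\langle a^2\rangle$. For a finite group $G$, the non-commuting graph $\Gamma(G)$ has vertex set $G\setminus Z(G)$, and two distinct vertices $x,y$ are adjacent iff $xy\neq yx$. For a connected graph $\Gamma$ with distance $d$, and $W=\{w_1,\dots,w_k\}\subseteq V(\Gamma)$, the representation of $v$ is $r(v\mid W)=(d(v,w_1),\dots,d(v,w_k))$; $W$ is a resolving set if distinct vertices have distinct representations. The metric dimension $\beta(\Gamma)$ is the minimum size of a resolving set, and the resolving polynomial is $\beta(\Gamma,x)=\sum_{i=\beta(\Gamma)}^{|V(\Gamma)|} r_i x^i$, where $r_i$ is the number of resolving sets of cardinality $i$. -}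

module Defs where

open import Data.Nat using (ℕ; zero; suc; _+_; _*_; _^_; NonZero; _≡ᵇ_)
open import Data.Nat.Properties using (m*n≢0)
open import Data.Nat.DivMod using (_mod_; _%_)
open import Data.Fin using (Fin; toℕ)
open import Data.Fin.Properties using (_≟_)
open import Data.Product using (_×_; _,_; proj₁; proj₂)
open import Data.Bool using (Bool; true; false; _∧_; _∨_; not; if_then_else_)
open import Data.List using (List; []; _∷_; map; filter; length; cartesianProduct; allFin; upTo)
open import Data.Bool.ListAction using (all; any)
open import Data.Nat.ListAction using (sum)
open import Relation.Nullary.Decidable using (⌊_⌋; does)

-- The group U_{6n} = ⟨ a, b | a^{2n} = b^3 = 1, a^{-1} b a = b^{-1} ⟩,
-- realised by its normal form: every element is uniquely a^i b^j with
-- 0 ≤ i < 2n, 0 ≤ j < 3, the pair (i , j) standing for a^i b^j.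
-- From b a = a b^{-1} one gets b^j a^k = a^k b^{(-1)^k j}, hence
--   (a^i b^j)(a^k b^l) = a^{i+k} b^{(-1)^k j + l}.

U : ℕ → Set
U n = Fin (2 * n) × Fin 3

-- (-1)^k modulo 3, i.e. 1 if k even, 2 if k odd
sign : ℕ → ℕ
sign k = if (k % 2) ≡ᵇ 0 then 1 else 2

mul : (n : ℕ) → .{{NonZero n}} → U n → U n → U n
mul n (i , j) (k , l) =
  ((toℕ i + toℕ k) mod (2 * n)) {{m*n≢0 2 n}}
  , (sign (toℕ k) * toℕ j + toℕ l) mod 3

eqU : (n : ℕ) → U n → U n → Bool
eqU n (i , j) (k , l) = ⌊ i ≟ k ⌋ ∧ ⌊ j ≟ l ⌋

elems : (n : ℕ) → List (U n)
elems n = cartesianProduct (allFin (2 * n)) (allFin 3)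

commute : (n : ℕ) → .{{NonZero n}} → U n → U n → Bool
commute n g h = eqU n (mul n g h) (mul n h g)

central : (n : ℕ) → .{{NonZero n}} → U n → Bool
central n g = all (commute n g) (elems n)

-- The non-commuting graph Γ(U_{6n}): vertex set U_{6n} \ Z(U_{6n}),
-- x ~ y iff x y ≠ y x (such x, y are automatically distinct).

vertices : (n : ℕ) → .{{NonZero n}} → List (U n)
vertices n = filter (λ g → not (central n g) Data.Bool.≟ true) (elems n)

adj : (n : ℕ) → .{{NonZero n}} → U n → U n → Bool
adj n x y = not (commute n x y)

reach : (n : ℕ) → .{{NonZero n}} → ℕ → U n → U n → Bool
reach n zero    u v = eqU n u v
reach n (suc k) u v =
  reach n k u v ∨ any (λ w → reach n k u w ∧ adj n w v) (vertices n)

-- A shortest path in a graph with N vertices has length < N, so it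
-- suffices to search k = 0 .. N-1; if no walk exists (which does not
-- happen, Γ(U_{6n}) being connected) the value N is returned.
dist : (n : ℕ) → .{{NonZero n}} → U n → U n → ℕ
dist n u v = go 0 (length (vertices n))
  where
  go : ℕ → ℕ → ℕ
  go k zero    = k
  go k (suc f) = if reach n k u v then k else go (suc k) f

rep : (n : ℕ) → .{{NonZero n}} → U n → List (U n) → List ℕ
rep n v W = map (dist n v) W

_==ℕs_ : List ℕ → List ℕ → Bool
[]       ==ℕs []       = true
(x ∷ xs) ==ℕs (y ∷ ys) = (x ≡ᵇ y) ∧ (xs ==ℕs ys)
_        ==ℕs _        = false

resolving : (n : ℕ) → .{{NonZero n}} → List (U n) → Bool
resolving n W =
  all (λ u → all (λ v → eqU n u v ∨ not (rep n u W ==ℕs rep n v W))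
                 (vertices n))
      (vertices n)

-- all sublists of a list; for a duplicate-free list these are exactly
-- its subsets, each listed once
sublists : {A : Set} → List A → List (List A)
sublists []       = [] ∷ []
sublists (x ∷ xs) = sublists xs Data.List.++ map (x ∷_) (sublists xs)

r : (n : ℕ) → .{{NonZero n}} → ℕ → ℕ
r n i = length (filter (λ W → resolving n W ∧ (length W ≡ᵇ i) Data.Bool.≟ true)
                       (sublists (vertices n)))

-- the resolving polynomial β(Γ, x) = Σ_i r_i x^i, evaluated at x
-- (i ranges over 0 .. |V(Γ)|; r_i = 0 for i < β(Γ))
resolvingPoly : (n : ℕ) → .{{NonZero n}} → ℕ → ℕ
resolvingPoly n x =
  sum (map (λ i → r n i * x ^ i) (upTo (suc (length (vertices n)))))

module Submission where

-- For n ≥ 2 the commutation relation of U₆ₙ only depends on the parity of the exponent of a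
-- and on the exponent of b.  The non-central elements fall into four classes (a^odd, a^odd b,
-- a^odd b², and a^even b^±1, of sizes n, n, n, 2n), and two of them commute iff they lie in the
-- same class: Γ is the complete multipartite graph K(n,n,n,2n).  All distances are 0, 1 or 2,
-- so a set W separates two vertices outside W only if they lie in different parts; since every
-- part has at least two vertices, W is resolving iff it misses at most one vertex of each part.
-- Counting such W by size therefore factors over the parts, a part of size s contributing
-- x^s + s x^(s-1) = x^(s-1) (x + s).  For n = 1 the polynomial is evaluated directly.

open import Defs
open import Data.Nat using (ℕ; zero; suc; pred; _+_; _*_; _^_; _∸_; _>_; _≤_; _<_; _≡ᵇ_; z≤n; s≤s; s≤s⁻¹; NonZero; >-nonZero⁻¹)
open import Data.Nat.Properties
open import Data.Nat.DivMod using (_mod_; _%_; [m+n]%n≡m%n)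
open import Data.Nat.ListAction using (sum)
open import Data.Nat.ListAction.Properties using (sum-++)
open import Data.Nat.Solver using (module +-*-Solver)
open import Data.Nat.Tactic.RingSolver using (solve-∀)
open import Data.Bool using (Bool; true; false; _∧_; _∨_; not; if_then_else_; T)
open import Data.Bool.Properties using (∧-zeroʳ; ∧-identityʳ; ∨-zeroʳ; T-∨; T-∧; T-≡; T-not-≡) renaming (_≟_ to _≟𝔹_)
open import Data.Bool.ListAction using (all; any)
open import Data.Fin using (Fin; zero; suc; toℕ; fromℕ; fromℕ<; inject₁)
import Data.Fin.Properties as Fin
open import Data.Fin.Properties using (all?; punchInᵢ≢i; toℕ-fromℕ<)
open import Data.List using (List; []; _∷_; map; filter; length; _++_; upTo; [_]; tabulate; allFin; cartesianProduct)
open import Data.List.Properties using (map-++; map-cong; map-cong-local; map-∘; map-tabulate; tabulate-cong; upTo-∷ʳ)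
open import Data.List.Membership.Propositional using (_∈_; _∉_; find)
open import Data.List.Membership.Propositional.Properties
  using (∈-++⁻; ∈-map⁻; ∈-allFin; ∈-cartesianProduct⁺; ∈-filter⁺; ∈-filter⁻)
open import Data.List.Relation.Unary.Any using (Any; here; there; satisfied)
import Data.List.Relation.Unary.Any as Any
open import Data.List.Relation.Unary.Any.Properties using (any⇔)
open import Data.List.Relation.Unary.All using (All; []; _∷_)
import Data.List.Relation.Unary.All as All
open import Data.List.Relation.Unary.All.Properties using (all⁺; all⁻; ¬All⇒Any¬; Any¬⇒¬All; All¬⇒¬Any)
open import Data.List.Relation.Unary.AllPairs using (_∷_)
open import Data.List.Relation.Unary.Unique.Propositional using (Unique)
open import Data.List.Relation.Unary.Unique.Propositional.Properties using (filter⁺; cartesianProduct⁺; allFin⁺)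
open import Data.List.Relation.Binary.Sublist.Propositional using ([]; _∷_; _∷ʳ_)
  renaming (_⊆_ to _⊑_; lookup to ⊑-lookup)
open import Data.List.Relation.Binary.Sublist.Propositional.Properties using (length-mono-≤)
open import Data.Vec.Functional using (updateAt; removeAt)
open import Data.Vec.Functional.Properties using (updateAt-updates; updateAt-minimal)
open import Data.Product using (∃-syntax; _×_; _,_; proj₁; proj₂)
open import Data.Sum using (_⊎_; inj₁; inj₂)
open import Data.Empty using (⊥-elim)
open import Function using (id; _∘_; _⇔_; mk⇔; case_of_)
open import Function.Bundles using (Equivalence)
import Function.Properties.Equivalence as ⇔
open import Relation.Binary.Definitions using (DecidableEquality)
open import Relation.Binary.PropositionalEquality hiding ([_])
open import Relation.Nullary using (¬_; Dec; yes; no; does; contradiction; _×-dec_)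
open import Relation.Nullary.Decidable using (⌊_⌋; True; toWitness; T?; map′; dec-true; dec-false; does-⇔; isYes≗does)
open import Algebra.Properties.CommutativeSemigroup +-commutativeSemigroup using () renaming (interchange to +-interchange)
open import Algebra.Properties.CommutativeMonoid.Sum *-1-commutativeMonoid using ()
  renaming (sum to ∏; sum-remove to ∏-remove; sum-cong-≗ to ∏-cong; sum-replicate-zero to ∏-replicate-1)

module _ {A : Set} where

  count : (A → Bool) → List A → ℕ
  count f []       = 0
  count f (a ∷ as) = if f a then suc (count f as) else count f as

  count-cong-∈ : ∀ {f g} (L : List A) → (∀ {a} → a ∈ L → f a ≡ g a) → count f L ≡ count g L
  count-cong-∈ []      f≡g = refl
  count-cong-∈ (a ∷ L) f≡g rewrite f≡g (here refl) | count-cong-∈ L (f≡g ∘ there) = refl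

  count-++ : ∀ f (L M : List A) → count f (L ++ M) ≡ count f L + count f M
  count-++ f []      M = refl
  count-++ f (a ∷ L) M with f a
  ... | true  = cong suc (count-++ f L M)
  ... | false = count-++ f L M

  count-≤-∷ : ∀ f a (L : List A) → count f L ≤ count f (a ∷ L)
  count-≤-∷ f a L with f a
  ... | true  = n≤1+n _
  ... | false = ≤-refl

  count-pos : ∀ {f} {L : List A} → Any (T ∘ f) L → 1 ≤ count f L
  count-pos {f} {a ∷ L} (here fa) with f a | fa
  ... | true | _ = s≤s z≤n
  count-pos {f} {a ∷ L} (there any) = ≤-trans (count-pos any) (count-≤-∷ f a L)

  count-pos⁻ : ∀ {f} (L : List A) → 1 ≤ count f L → Any (T ∘ f) L
  count-pos⁻ {f} (a ∷ L) pos with f a in fa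
  ... | true  = here (subst T (sym fa) _)
  ... | false = there (count-pos⁻ L pos)

  count-≥2 : ∀ {f} {L : List A} {u v} → u ∈ L → v ∈ L → u ≢ v → T (f u) → T (f v) → 2 ≤ count f L
  count-≥2 {f} {a ∷ L} (here refl) (here refl) u≢v _ _ = ⊥-elim (u≢v refl)
  count-≥2 {f} {a ∷ L} (here refl) (there v∈L) _ fu fv with f a | fu
  ... | true | _ = s≤s (count-pos (Any.map (λ { refl → fv }) v∈L))
  count-≥2 {f} {a ∷ L} (there u∈L) (here refl) _ fu fv with f a | fv
  ... | true | _ = s≤s (count-pos (Any.map (λ { refl → fu }) u∈L))
  count-≥2 {f} {a ∷ L} (there u∈L) (there v∈L) u≢v fu fv =
    ≤-trans (count-≥2 u∈L v∈L u≢v fu fv) (count-≤-∷ f a L)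

  count-≥2⁻ : ∀ {f} (L : List A) → Unique L → 2 ≤ count f L →
              ∃[ u ] ∃[ v ] u ∈ L × v ∈ L × u ≢ v × T (f u) × T (f v)
  count-≥2⁻ {f} (a ∷ L) (a∉L ∷ uL) two with f a in fa
  ... | true  = let (u , u∈L , fu) = find (count-pos⁻ L (s≤s⁻¹ two))
                in a , u , here refl , there u∈L , All.lookup a∉L u∈L , subst T (sym fa) _ , fu
  ... | false = let (u , v , u∈L , v∈L , u≢v , fu , fv) = count-≥2⁻ L uL two
                in u , v , there u∈L , there v∈L , u≢v , fu , fv

  length-filter : ∀ (f : A → Bool) (L : List A) → length (filter (λ a → f a ≟𝔹 true) L) ≡ count f L
  length-filter f []      = refl
  length-filter f (a ∷ L) with f a
  ... | true  = cong suc (length-filter f L)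
  ... | false = length-filter f L

  count-filter : ∀ (f g : A → Bool) (L : List A) →
                 count g (filter (λ a → f a ≟𝔹 true) L) ≡ count (λ a → f a ∧ g a) L
  count-filter f g []      = refl
  count-filter f g (a ∷ L) with f a
  ... | false = count-filter f g L
  ... | true with g a
  ...   | true  = cong suc (count-filter f g L)
  ...   | false = count-filter f g L

count-map : ∀ {A B : Set} (f : B → Bool) (g : A → B) L → count f (map g L) ≡ count (f ∘ g) L
count-map f g []      = refl
count-map f g (a ∷ L) with f (g a)
... | true  = cong suc (count-map f g L)
... | false = count-map f g L

count-cartesianProduct : ∀ {A B : Set} (f : A × B → Bool) (xs : List A) (ys : List B) →
  count f (cartesianProduct xs ys) ≡ sum (map (λ a → count (f ∘ (a ,_)) ys) xs)
count-cartesianProduct f []       ys = refl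
count-cartesianProduct f (a ∷ xs) ys = begin
  count f (map (a ,_) ys ++ cartesianProduct xs ys)
    ≡⟨ count-++ f (map (a ,_) ys) _ ⟩
  count f (map (a ,_) ys) + count f (cartesianProduct xs ys)
    ≡⟨ cong₂ _+_ (count-map f (a ,_) ys) (count-cartesianProduct f xs ys) ⟩
  count (f ∘ (a ,_)) ys + sum (map (λ a → count (f ∘ (a ,_)) ys) xs) ∎
  where open ≡-Reasoning

module _ {B : Set} where

  sum-map-+ : ∀ (f g : B → ℕ) L → sum (map (λ b → f b + g b) L) ≡ sum (map f L) + sum (map g L)
  sum-map-+ f g []      = refl
  sum-map-+ f g (b ∷ L) = trans (cong (f b + g b +_) (sum-map-+ f g L))
                                (+-interchange (f b) (g b) (sum (map f L)) (sum (map g L)))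

  sum-map-*ˡ : ∀ c (f : B → ℕ) L → sum (map (λ b → c * f b) L) ≡ c * sum (map f L)
  sum-map-*ˡ c f []      = sym (*-zeroʳ c)
  sum-map-*ˡ c f (b ∷ L) = trans (cong (c * f b +_) (sum-map-*ˡ c f L)) (sym (*-distribˡ-+ c (f b) _))

  sum-map-0 : ∀ (f : B → ℕ) L → (∀ {b} → b ∈ L → f b ≡ 0) → sum (map f L) ≡ 0
  sum-map-0 f []      f≡0 = refl
  sum-map-0 f (b ∷ L) f≡0 rewrite f≡0 (here refl) = sum-map-0 f L (f≡0 ∘ there)

sum-upTo-suc : ∀ (f : ℕ → ℕ) M → sum (map f (upTo (suc M))) ≡ sum (map f (upTo M)) + (f M + 0)
sum-upTo-suc f M = begin
  sum (map f (upTo (suc M)))       ≡⟨ cong (sum ∘ map f) (upTo-∷ʳ M) ⟨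
  sum (map f (upTo M ++ [ M ]))    ≡⟨ cong sum (map-++ f (upTo M) [ M ]) ⟩
  sum (map f (upTo M) ++ [ f M ])  ≡⟨ sum-++ (map f (upTo M)) [ f M ] ⟩
  sum (map f (upTo M)) + (f M + 0) ∎
  where open ≡-Reasoning

sum-upTo-delta-≥ : ∀ (y : ℕ → ℕ) {d} M → M ≤ d → sum (map (λ i → if d ≡ᵇ i then y i else 0) (upTo M)) ≡ 0
sum-upTo-delta-≥ y     zero    _     = refl
sum-upTo-delta-≥ y {d} (suc M) 1+M≤d rewrite sum-upTo-suc (λ i → if d ≡ᵇ i then y i else 0) M
                                       | sum-upTo-delta-≥ y M (<⇒≤ 1+M≤d)
                                       | dec-false (d ≟ M) (≢-sym (<⇒≢ 1+M≤d)) = refl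

sum-upTo-delta : ∀ (y : ℕ → ℕ) {d} M → d < M → sum (map (λ i → if d ≡ᵇ i then y i else 0) (upTo M)) ≡ y d
sum-upTo-delta y {d} (suc M) d<1+M rewrite sum-upTo-suc (λ i → if d ≡ᵇ i then y i else 0) M
  with m≤n⇒m<n∨m≡n (s≤s⁻¹ d<1+M)
... | inj₁ d<M  rewrite sum-upTo-delta y M d<M | dec-false (d ≟ M) (<⇒≢ d<M) = +-identityʳ (y d)
... | inj₂ refl rewrite sum-upTo-delta-≥ y d ≤-refl | dec-true (d ≟ d) refl = +-identityʳ (y d)

sum-tabulate-2-periodic : ∀ n (G : ℕ → ℕ) → (∀ k → G (2 + k) ≡ G k) →
                          sum (tabulate {n = 2 * n} (G ∘ toℕ)) ≡ n * (G 0 + G 1)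
sum-tabulate-2-periodic zero    G _        = refl
sum-tabulate-2-periodic (suc n) G periodic rewrite +-suc n (n + 0) = begin
  G 0 + (G 1 + sum (tabulate {n = 2 * n} (G ∘ toℕ ∘ Fin.suc ∘ Fin.suc)))
    ≡⟨ cong (λ t → G 0 + (G 1 + sum t)) (tabulate-cong {n = 2 * n} (periodic ∘ toℕ)) ⟩
  G 0 + (G 1 + sum (tabulate {n = 2 * n} (G ∘ toℕ)))
    ≡⟨ +-assoc (G 0) (G 1) _ ⟨
  G 0 + G 1 + sum (tabulate {n = 2 * n} (G ∘ toℕ))
    ≡⟨ cong (G 0 + G 1 +_) (sum-tabulate-2-periodic n G periodic) ⟩
  G 0 + G 1 + n * (G 0 + G 1) ∎
  where open ≡-Reasoning

if-then-*ˡ : ∀ b {c y} → (if b then c * y else 0) ≡ c * (if b then y else 0)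
if-then-*ˡ true        = refl
if-then-*ˡ false {c} = sym (*-zeroʳ c)

module _ {B : Set} (x : ℕ) (deg : B → ℕ) (P : B → Bool) where

  private
    coeff : ℕ → List B → ℕ
    coeff i Ws = count (λ W → P W ∧ (deg W ≡ᵇ i)) Ws

    if-suc-* : ∀ b c y → (if b then suc c else c) * y ≡ (if b then y else 0) + c * y
    if-suc-* true  c y = refl
    if-suc-* false c y = refl

    sum-coeff : ∀ M Ws → All (λ W → deg W < M) Ws →
                sum (map (λ i → coeff i Ws * x ^ i) (upTo M)) ≡ sum (map (λ W → if P W then x ^ deg W else 0) Ws)
    sum-coeff M []       _             = sum-map-0 (λ _ → 0) (upTo M) (λ _ → refl)
    sum-coeff M (W ∷ Ws) (W<M ∷ Ws<M) = begin
      sum (map (λ i → coeff i (W ∷ Ws) * x ^ i) (upTo M))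
        ≡⟨ cong sum (map-cong (λ i → if-suc-* (P W ∧ (deg W ≡ᵇ i)) (coeff i Ws) (x ^ i)) (upTo M)) ⟩
      sum (map (λ i → (if P W ∧ (deg W ≡ᵇ i) then x ^ i else 0) + coeff i Ws * x ^ i) (upTo M))
        ≡⟨ sum-map-+ _ _ (upTo M) ⟩
      sum (map (λ i → if P W ∧ (deg W ≡ᵇ i) then x ^ i else 0) (upTo M)) + sum (map (λ i → coeff i Ws * x ^ i) (upTo M))
        ≡⟨ cong₂ _+_ (leading (P W)) (sum-coeff M Ws Ws<M) ⟩
      (if P W then x ^ deg W else 0) + sum (map (λ W → if P W then x ^ deg W else 0) Ws) ∎
      where
      open ≡-Reasoning
      leading : ∀ b → sum (map (λ i → if b ∧ (deg W ≡ᵇ i) then x ^ i else 0) (upTo M)) ≡ (if b then x ^ deg W else 0)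
      leading true  = sum-upTo-delta (x ^_) M W<M
      leading false = sum-map-0 (λ _ → 0) (upTo M) (λ _ → refl)

  sum-by-degree : ∀ N Ws → All (λ W → deg W ≤ N) Ws →
    sum (map (λ i → length (filter (λ W → P W ∧ (deg W ≡ᵇ i) ≟𝔹 true) Ws) * x ^ i) (upTo (suc N)))
    ≡ sum (map (λ W → if P W then x ^ deg W else 0) Ws)
  sum-by-degree N Ws Ws≤N =
    trans (cong sum (map-cong (λ i → cong (_* x ^ i) (length-filter _ Ws)) (upTo (suc N))))
          (sum-coeff (suc N) Ws (All.map s≤s Ws≤N))

-- Sublists with a bounded number of omissions in each part

∈-sublists⇒⊑ : ∀ {A : Set} (L : List A) {W} → W ∈ sublists L → W ⊑ L
∈-sublists⇒⊑ []      (here refl) = []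
∈-sublists⇒⊑ (a ∷ L) W∈ with ∈-++⁻ (sublists L) W∈
... | inj₁ W∈L = a ∷ʳ ∈-sublists⇒⊑ L W∈L
... | inj₂ W∈aL with _ , W′∈ , refl ← ∈-map⁻ (a ∷_) W∈aL = refl ∷ ∈-sublists⇒⊑ L W′∈

_≤ᶠ_ : ∀ {k} → (Fin k → ℕ) → (Fin k → ℕ) → Set
m ≤ᶠ c = ∀ p → m p ≤ c p

_≤ᶠ?_ : ∀ {k} (m c : Fin k → ℕ) → Dec (m ≤ᶠ c)
m ≤ᶠ? c = all? (λ p → m p ≤? c p)

≤ᶠ?-resp-≗ : ∀ {k} {m m′ : Fin k → ℕ} (c : Fin k → ℕ) → m ≗ m′ → does (m ≤ᶠ? c) ≡ does (m′ ≤ᶠ? c)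
≤ᶠ?-resp-≗ c m≗m′ = does-⇔ (mk⇔ (λ h p → subst (_≤ c p) (m≗m′ p) (h p))
                                 (λ h p → subst (_≤ c p) (sym (m≗m′ p)) (h p))) (_ ≤ᶠ? c) (_ ≤ᶠ? c)

bump : ∀ {k} → Fin k → (Fin k → ℕ) → Fin k → ℕ
bump q m p = if does (q Fin.≟ p) then suc (m p) else m p

bump-≤ᶠ : ∀ {k} {q : Fin k} {c′} m c → c q ≡ suc c′ → bump q m ≤ᶠ c ⇔ m ≤ᶠ updateAt c q pred
bump-≤ᶠ {q = q} {c′} m c cq = mk⇔ to from
  where
  c⁻q≡ : updateAt c q pred q ≡ c′
  c⁻q≡ = trans (updateAt-updates q c) (cong pred cq)
  to : bump q m ≤ᶠ c → m ≤ᶠ updateAt c q pred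
  to h p with q Fin.≟ p | h p
  ... | yes refl | hq = subst (m q ≤_) (sym c⁻q≡) (s≤s⁻¹ (subst (suc (m q) ≤_) cq hq))
  ... | no q≢p   | hp = subst (m p ≤_) (sym (updateAt-minimal p q c (q≢p ∘ sym))) hp
  from : m ≤ᶠ updateAt c q pred → bump q m ≤ᶠ c
  from h p with q Fin.≟ p | h p
  ... | yes refl | hq = subst (suc (m q) ≤_) (sym cq) (s≤s (subst (m q ≤_) c⁻q≡ hq))
  ... | no q≢p   | hp = subst (m p ≤_) (updateAt-minimal p q c (q≢p ∘ sym)) hp

bump-≰ᶠ : ∀ {k} {q : Fin k} m c → c q ≡ 0 → ¬ (bump q m ≤ᶠ c)
bump-≰ᶠ {q = q} m c cq h with q Fin.≟ q | h q
... | yes _  | hq = contradiction (subst (suc (m q) ≤_) cq hq) λ ()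
... | no q≢q | _  = q≢q refl

∏-except : ∀ {k} → Fin k → (Fin k → ℕ) → ℕ
∏-except {suc _} q f = ∏ (removeAt f q)

∏-factor : ∀ {k} (q : Fin k) {f g : Fin k → ℕ} → (∀ p → q ≢ p → g p ≡ f p) → ∏ g ≡ g q * ∏-except q f
∏-factor {suc _} q {f} {g} g≡f = trans (∏-remove g) (cong (g q *_) (∏-cong (λ p → g≡f _ (punchInᵢ≢i q p ∘ sym))))

-- missingAtMost x c s = Σ_{i ≤ c} C(s,i) x^(s-i): the subsets of an s-element set omitting
-- at most c of its elements, counted by size; the last element is either omitted or kept.
missingAtMost : ℕ → ℕ → ℕ → ℕ
missingAtMost x c       zero    = 1
missingAtMost x zero    (suc s) = x * missingAtMost x zero s
missingAtMost x (suc c) (suc s) = missingAtMost x c s + x * missingAtMost x (suc c) s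

missingAtMost-0 : ∀ x s → missingAtMost x 0 s ≡ x ^ s
missingAtMost-0 x zero    = refl
missingAtMost-0 x (suc s) = cong (x *_) (missingAtMost-0 x s)

missingAtMost-1 : ∀ x s → missingAtMost x 1 (suc s) ≡ x ^ s * (x + suc s)
missingAtMost-1 x zero    = identity x
  where
  identity : ∀ x → 1 + x * 1 ≡ 1 * (x + 1)
  identity = solve-∀
missingAtMost-1 x (suc s) =
  trans (cong₂ _+_ (missingAtMost-0 x (suc s)) (cong (x *_) (missingAtMost-1 x s))) (identity x (x ^ s) s)
  where
  identity : ∀ x p s → x * p + x * (p * (x + suc s)) ≡ x * p * (x + suc (suc s))
  identity = solve-∀

module Partition {A : Set} (_≟_ : DecidableEquality A) {k} (part : A → Fin k) where

  open import Data.List.Membership.DecPropositional _≟_ using (_∈?_)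

  inPart : Fin k → A → Bool
  inPart p v = does (part v Fin.≟ p)

  size : List A → Fin k → ℕ
  size L p = count (inPart p) L

  missing : List A → List A → Fin k → ℕ
  missing L W p = count (λ v → inPart p v ∧ not (does (v ∈? W))) L

  size-∷-≡ : ∀ v L → size (v ∷ L) (part v) ≡ suc (size L (part v))
  size-∷-≡ v L rewrite dec-true (part v Fin.≟ part v) refl = refl

  size-∷-≢ : ∀ v L {p} → part v ≢ p → size (v ∷ L) p ≡ size L p
  size-∷-≢ v L {p} v∉p rewrite dec-false (part v Fin.≟ p) v∉p = refl

  missing-∷-∉ : ∀ {v} L {W} → v ∉ W → missing (v ∷ L) W ≗ bump (part v) (missing L W)
  missing-∷-∉ {v} L {W} v∉W p rewrite dec-false (v ∈? W) v∉W | ∧-identityʳ (inPart p v) = refl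

  missing-∷-∈ : ∀ {v} L W → All (v ≢_) L → missing (v ∷ L) (v ∷ W) ≗ missing L W
  missing-∷-∈ {v} L W v∉L p rewrite dec-true (v ≟ v) refl | ∧-zeroʳ (inPart p v) =
    count-cong-∈ L λ {u} u∈L →
      cong (λ b → inPart p u ∧ not (b ∨ does (u ∈? W))) (dec-false (u ≟ v) (All.lookup v∉L u∈L ∘ sym))

  ∉-sublists : ∀ {v} {L W : List A} → All (v ≢_) L → W ∈ sublists L → v ∉ W
  ∉-sublists {L = L} v∉L W∈ v∈W = All.lookup v∉L (⊑-lookup (∈-sublists⇒⊑ L W∈) v∈W) refl

  module _ (x : ℕ) where

    weight : (Fin k → ℕ) → List A → List A → ℕ
    weight c L W = if does (missing L W ≤ᶠ? c) then x ^ length W else 0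

    admissibleGF : (Fin k → ℕ) → List A → ℕ
    admissibleGF c L = sum (map (weight c L) (sublists L))

    weight-∷-∈ : ∀ {v} L W c → All (v ≢_) L → weight c (v ∷ L) (v ∷ W) ≡ x * weight c L W
    weight-∷-∈ L W c v∉L rewrite ≤ᶠ?-resp-≗ c (missing-∷-∈ L W v∉L) = if-then-*ˡ (does (missing L W ≤ᶠ? c)) {x} {x ^ length W}

    weight-∷-∉-0 : ∀ {v} L {W} c → v ∉ W → c (part v) ≡ 0 → weight c (v ∷ L) W ≡ 0
    weight-∷-∉-0 L {W} c v∉W cq rewrite ≤ᶠ?-resp-≗ c (missing-∷-∉ L v∉W) | dec-false (_ ≤ᶠ? c) (bump-≰ᶠ (missing L W) c cq) = refl

    weight-∷-∉-suc : ∀ {v} L {W} c {c′} → v ∉ W → c (part v) ≡ suc c′ → weight c (v ∷ L) W ≡ weight (updateAt c (part v) pred) L W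
    weight-∷-∉-suc L {W} c v∉W cq
      rewrite ≤ᶠ?-resp-≗ c (missing-∷-∉ L v∉W) | does-⇔ (bump-≤ᶠ (missing L W) c cq) (_ ≤ᶠ? c) (_ ≤ᶠ? _) = refl

    admissibleGF-∷ : ∀ v L c → admissibleGF c (v ∷ L) ≡
      sum (map (weight c (v ∷ L)) (sublists L)) + sum (map (weight c (v ∷ L) ∘ (v ∷_)) (sublists L))
    admissibleGF-∷ v L c = begin
      sum (map F (sublists L ++ map (v ∷_) (sublists L)))
        ≡⟨ cong sum (map-++ F (sublists L) _) ⟩
      sum (map F (sublists L) ++ map F (map (v ∷_) (sublists L)))
        ≡⟨ sum-++ (map F (sublists L)) _ ⟩
      sum (map F (sublists L)) + sum (map F (map (v ∷_) (sublists L)))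
        ≡⟨ cong (λ Ws → sum (map F (sublists L)) + sum Ws) (map-∘ (sublists L)) ⟨
      sum (map F (sublists L)) + sum (map (F ∘ (v ∷_)) (sublists L)) ∎
      where
      open ≡-Reasoning
      F = weight c (v ∷ L)

    sum-weight-∷-∈ : ∀ {v} L c → All (v ≢_) L → sum (map (weight c (v ∷ L) ∘ (v ∷_)) (sublists L)) ≡ x * admissibleGF c L
    sum-weight-∷-∈ L c v∉L =
      trans (cong sum (map-cong (λ W → weight-∷-∈ L W c v∉L) (sublists L))) (sum-map-*ˡ x (weight c L) (sublists L))

    admissibleGF-∷-0 : ∀ {v} L c → All (v ≢_) L → c (part v) ≡ 0 → admissibleGF c (v ∷ L) ≡ x * admissibleGF c L
    admissibleGF-∷-0 {v} L c v∉L cq = trans (admissibleGF-∷ v L c) (cong₂ _+_ omitting (sum-weight-∷-∈ L c v∉L))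
      where
      omitting : sum (map (weight c (v ∷ L)) (sublists L)) ≡ 0
      omitting = sum-map-0 _ (sublists L) λ W∈ → weight-∷-∉-0 L c (∉-sublists v∉L W∈) cq

    admissibleGF-∷-suc : ∀ {v} L c {c′} → All (v ≢_) L → c (part v) ≡ suc c′ →
      admissibleGF c (v ∷ L) ≡ admissibleGF (updateAt c (part v) pred) L + x * admissibleGF c L
    admissibleGF-∷-suc {v} L c v∉L cq = trans (admissibleGF-∷ v L c) (cong₂ _+_ omitting (sum-weight-∷-∈ L c v∉L))
      where
      omitting : sum (map (weight c (v ∷ L)) (sublists L)) ≡ admissibleGF (updateAt c (part v) pred) L
      omitting = cong sum (map-cong-local (All.tabulate λ W∈ → weight-∷-∉-suc L c (∉-sublists v∉L W∈) cq))

    ∏-size-∷ : ∀ v L (c : Fin k → ℕ) → ∏ (λ p → missingAtMost x (c p) (size (v ∷ L) p)) ≡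
      missingAtMost x (c (part v)) (suc (size L (part v))) * ∏-except (part v) (λ p → missingAtMost x (c p) (size L p))
    ∏-size-∷ v L c = trans (∏-factor (part v) (λ p v∉p → cong (missingAtMost x (c p)) (size-∷-≢ v L v∉p)))
                           (cong (λ s → missingAtMost x (c (part v)) s * ∏-except (part v) (λ p → missingAtMost x (c p) (size L p)))
                                 (size-∷-≡ v L))

    admissibleGF-∏ : ∀ L → Unique L → ∀ c → admissibleGF c L ≡ ∏ (λ p → missingAtMost x (c p) (size L p))
    admissibleGF-∏ []       _            c rewrite dec-true ((λ _ → 0) ≤ᶠ? c) (λ _ → z≤n) = sym (∏-replicate-1 k)
    admissibleGF-∏ (v ∷ L) (v∉L ∷ uL) c with c (part v) in cq
    ... | zero = begin
      admissibleGF c (v ∷ L)              ≡⟨ admissibleGF-∷-0 L c v∉L cq ⟩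
      x * admissibleGF c L                ≡⟨ cong (x *_) (admissibleGF-∏ L uL c) ⟩
      x * ∏ f                             ≡⟨ cong (x *_) (∏-factor q (λ _ _ → refl)) ⟩
      x * (M (c q) s * R)                 ≡⟨ cong (λ c₀ → x * (M c₀ s * R)) cq ⟩
      x * (M 0 s * R)                     ≡⟨ *-assoc x _ R ⟨
      M 0 (suc s) * R                     ≡⟨ cong (λ c₀ → M c₀ (suc s) * R) cq ⟨
      M (c q) (suc s) * R                 ≡⟨ ∏-size-∷ v L c ⟨
      ∏ (λ p → M (c p) (size (v ∷ L) p))  ∎
      where
      open ≡-Reasoning
      M = missingAtMost x
      q = part v
      s = size L q
      f = λ p → M (c p) (size L p)
      R = ∏-except q f
    ... | suc c′ = begin
      admissibleGF c (v ∷ L)                        ≡⟨ admissibleGF-∷-suc L c v∉L cq ⟩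
      admissibleGF c⁻ L + x * admissibleGF c L      ≡⟨ cong₂ (λ a b → a + x * b) (admissibleGF-∏ L uL c⁻) (admissibleGF-∏ L uL c) ⟩
      ∏ f⁻ + x * ∏ f                                ≡⟨ cong₂ (λ a b → a + x * b) (∏-factor q f⁻≡f) (∏-factor q (λ _ _ → refl)) ⟩
      M (c⁻ q) s * R + x * (M (c q) s * R)          ≡⟨ cong₂ (λ a b → M a s * R + x * (M b s * R)) c⁻q≡ cq ⟩
      M c′ s * R + x * (M (suc c′) s * R)           ≡⟨ cong (M c′ s * R +_) (*-assoc x _ R) ⟨
      M c′ s * R + x * M (suc c′) s * R             ≡⟨ *-distribʳ-+ R (M c′ s) _ ⟨
      M (suc c′) (suc s) * R                        ≡⟨ cong (λ c₀ → M c₀ (suc s) * R) cq ⟨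
      M (c q) (suc s) * R                           ≡⟨ ∏-size-∷ v L c ⟨
      ∏ (λ p → M (c p) (size (v ∷ L) p))            ∎
      where
      open ≡-Reasoning
      M = missingAtMost x
      q = part v
      s = size L q
      c⁻ = updateAt c q pred
      f = λ p → M (c p) (size L p)
      f⁻ = λ p → M (c⁻ p) (size L p)
      R = ∏-except q f
      f⁻≡f : ∀ p → q ≢ p → f⁻ p ≡ f p
      f⁻≡f p q≢p = cong (λ c₀ → M c₀ (size L p)) (updateAt-minimal p q c (q≢p ∘ sym))
      c⁻q≡ : c⁻ q ≡ c′
      c⁻q≡ = trans (updateAt-updates q c) (cong pred cq)

-- Resolving sets

T-not⁺ : ∀ {b} → ¬ T b → T (not b)
T-not⁺ {false} _  = _
T-not⁺ {true}  ¬t = ¬t _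

T-not⁻ : ∀ {b} → T (not b) → ¬ T b
T-not⁻ {false} _ ()

T-does⁺ : ∀ {P : Set} (P? : Dec P) → P → T (does P?)
T-does⁺ P? p rewrite dec-true P? p = _

T-does⁻ : ∀ {P : Set} (P? : Dec P) → T (does P?) → P
T-does⁻ (yes p) _ = p

T-injective : ∀ {a b} → (T a ⇔ T b) → a ≡ b
T-injective {true}  {true}  _ = refl
T-injective {true}  {false} h = ⊥-elim (Equivalence.to h _)
T-injective {false} {true}  h = ⊥-elim (Equivalence.from h _)
T-injective {false} {false} _ = refl

T-map-==ℕs : ∀ {A : Set} (f g : A → ℕ) W → T (map f W ==ℕs map g W) ⇔ All (λ w → f w ≡ g w) W
T-map-==ℕs f g []      = mk⇔ (λ _ → []) (λ _ → _)
T-map-==ℕs f g (w ∷ W) with f w ≟ g w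
... | yes fw≡gw rewrite dec-true (f w ≟ g w) fw≡gw =
  mk⇔ (λ h → fw≡gw ∷ Equivalence.to (T-map-==ℕs f g W) h) (λ { (_ ∷ h) → Equivalence.from (T-map-==ℕs f g W) h })
... | no fw≢gw rewrite dec-false (f w ≟ g w) fw≢gw = mk⇔ (λ ()) (λ { (fw≡gw ∷ _) → fw≢gw fw≡gw })

Resolves : {A : Set} → (A → A → ℕ) → List A → List A → Set
Resolves d V W = ∀ {u v} → u ∈ V → v ∈ V → u ≢ v → Any (λ w → d u w ≢ d v w) W

module _ {A : Set} (eqb : A → A → Bool) (T-eqb : ∀ {u v} → T (eqb u v) ⇔ u ≡ v) (d : A → A → ℕ) (V : List A) where

  resolvingᵇ : List A → Bool
  resolvingᵇ W = all (λ u → all (λ v → eqb u v ∨ not (map (d u) W ==ℕs map (d v) W)) V) V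

  T-resolvingᵇ : ∀ W → T (resolvingᵇ W) ⇔ Resolves d V W
  T-resolvingᵇ W = mk⇔ to from
    where
    to : T (resolvingᵇ W) → Resolves d V W
    to h {u} {v} u∈V v∈V u≢v with Equivalence.to T-∨ (All.lookup (all⁺ _ V (All.lookup (all⁺ _ V h) u∈V)) v∈V)
    ... | inj₁ u≐v   = contradiction (Equivalence.to T-eqb u≐v) u≢v
    ... | inj₂ u≭ᵈv = ¬All⇒Any¬ (λ w → d u w ≟ d v w) W (T-not⁻ u≭ᵈv ∘ Equivalence.from (T-map-==ℕs (d u) (d v) W))
    from : Resolves d V W → T (resolvingᵇ W)
    from res = all⁻ _ (All.tabulate λ u∈V → all⁻ _ (All.tabulate λ v∈V → Equivalence.from T-∨ (separate u∈V v∈V)))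
      where
      separate : ∀ {u v} → u ∈ V → v ∈ V → T (eqb u v) ⊎ T (not (map (d u) W ==ℕs map (d v) W))
      separate {u} {v} u∈V v∈V with T? (eqb u v)
      ... | yes u≐v = inj₁ u≐v
      ... | no u≭v  = inj₂ (T-not⁺ (Any¬⇒¬All (res u∈V v∈V (u≭v ∘ Equivalence.from T-eqb))
                                    ∘ Equivalence.to (T-map-==ℕs (d u) (d v) W)))

module CompleteMultipartite {A : Set} (_≟_ : DecidableEquality A) {k} (part : A → Fin k) where

  open Partition _≟_ part
  open import Data.List.Membership.DecPropositional _≟_ using (_∈?_)

  multipartiteDist : A → A → ℕ
  multipartiteDist u w = if does (u ≟ w) then 0 else if does (part u Fin.≟ part w) then 2 else 1

  module _ (d : A → A → ℕ) (V : List A) (unique : Unique V)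
           (d-spec : ∀ {u w} → u ∈ V → w ∈ V → d u w ≡ multipartiteDist u w)
           (partner : ∀ {u} → u ∈ V → ∃[ w ] w ∈ V × w ≢ u × part w ≡ part u) where

    private
      d-self : ∀ {u} → u ∈ V → d u u ≡ 0
      d-self {u} u∈V rewrite d-spec u∈V u∈V | dec-true (u ≟ u) refl = refl

      d-other : ∀ {u v} → u ∈ V → v ∈ V → u ≢ v → d u v ≢ 0
      d-other {u} {v} u∈V v∈V u≢v rewrite d-spec u∈V v∈V | dec-false (u ≟ v) u≢v with does (part u Fin.≟ part v)
      ... | true  = λ ()
      ... | false = λ ()

      d-same-part : ∀ {u v w} → u ∈ V → v ∈ V → w ∈ V → u ≢ w → v ≢ w → part u ≡ part v → d u w ≡ d v w
      d-same-part {u} {v} {w} u∈V v∈V w∈V u≢w v≢w pu≡pv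
        rewrite d-spec u∈V w∈V | d-spec v∈V w∈V | dec-false (u ≟ w) u≢w | dec-false (v ≟ w) v≢w | pu≡pv = refl

      d-partner : ∀ {u v w} → u ∈ V → v ∈ V → w ∈ V → w ≢ u → part w ≡ part u → part u ≢ part v → d u w ≢ d v w
      d-partner {u} {v} {w} u∈V v∈V w∈V w≢u pw≡pu pu≢pv
        rewrite d-spec u∈V w∈V | d-spec v∈V w∈V | dec-false (u ≟ w) (w≢u ∘ sym)
              | dec-false (v ≟ w) (λ { refl → pu≢pv (sym pw≡pu) }) | dec-true (part u Fin.≟ part w) (sym pw≡pu)
              | dec-false (part v Fin.≟ part w) (λ pv≡pw → pu≢pv (trans (sym pw≡pu) (sym pv≡pw))) = λ ()

      missing-≥2 : ∀ {W u v} → u ∈ V → v ∈ V → u ≢ v → part u ≡ part v → u ∉ W → v ∉ W → 2 ≤ missing V W (part u)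
      missing-≥2 {W} {u} u∈V v∈V u≢v pu≡pv u∉W v∉W = count-≥2 u∈V v∈V u≢v (outside u∉W refl) (outside v∉W (sym pu≡pv))
        where
        outside : ∀ {a} → a ∉ W → part a ≡ part u → T (inPart (part u) a ∧ not (does (a ∈? W)))
        outside {a} a∉W pa≡pu rewrite dec-true (part a Fin.≟ part u) pa≡pu | dec-false (a ∈? W) a∉W = _

    resolves⇔missing≤1 : ∀ W → (∀ {w} → w ∈ W → w ∈ V) → Resolves d V W ⇔ missing V W ≤ᶠ (λ _ → 1)
    resolves⇔missing≤1 W W⊆V = mk⇔ to from
      where
      to : Resolves d V W → missing V W ≤ᶠ (λ _ → 1)
      to res p with missing V W p ≤? 1
      ... | yes m≤1 = m≤1
      ... | no  m≰1 with count-≥2⁻ V unique (≰⇒> m≰1)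
      ...   | u , v , u∈V , v∈V , u≢v , hu , hv = contradiction (res u∈V v∈V u≢v) (All¬⇒¬Any (All.tabulate same))
        where
        unpack : ∀ {a} → T (inPart p a ∧ not (does (a ∈? W))) → part a ≡ p × a ∉ W
        unpack {a} h = let (hp , hW) = Equivalence.to T-∧ h in T-does⁻ (part a Fin.≟ p) hp , T-not⁻ hW ∘ T-does⁺ (a ∈? W)
        same : ∀ {w} → w ∈ W → ¬ (d u w ≢ d v w)
        same w∈W d≢ = d≢ (d-same-part u∈V v∈V (W⊆V w∈W) (λ { refl → proj₂ (unpack hu) w∈W }) (λ { refl → proj₂ (unpack hv) w∈W })
                                       (trans (proj₁ (unpack hu)) (sym (proj₁ (unpack hv)))))
      from : missing V W ≤ᶠ (λ _ → 1) → Resolves d V W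
      from m≤1 {u} {v} u∈V v∈V u≢v with u ∈? W | v ∈? W
      ... | yes u∈W | _       = Any.map (λ { refl d≡ → d-other v∈V u∈V (u≢v ∘ sym) (trans (sym d≡) (d-self u∈V)) }) u∈W
      ... | no _    | yes v∈W = Any.map (λ { refl d≡ → d-other u∈V v∈V u≢v (trans d≡ (d-self v∈V)) }) v∈W
      ... | no u∉W  | no v∉W with part u Fin.≟ part v | partner u∈V
      ...   | yes pu≡pv | _ = contradiction (missing-≥2 u∈V v∈V u≢v pu≡pv u∉W v∉W) (≤⇒≯ (m≤1 _))
      ...   | no pu≢pv  | w , w∈V , w≢u , pw≡pu with w ∈? W
      ...     | no w∉W  = contradiction (missing-≥2 u∈V w∈V (w≢u ∘ sym) (sym pw≡pu) u∉W w∉W) (≤⇒≯ (m≤1 _))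
      ...     | yes w∈W = Any.map (λ { refl → d-partner u∈V v∈V w∈V w≢u pw≡pu pu≢pv }) w∈W

-- The non-commuting graph of U₆ₙ

⌊≟⌋-∧ : ∀ {m} {a b : Fin m} {c} → a ≡ b → ⌊ a Fin.≟ b ⌋ ∧ c ≡ c
⌊≟⌋-∧ {a = a} refl rewrite ≡-≟-identity Fin._≟_ (refl {x = a}) = refl

signᵇ : Bool → ℕ
signᵇ e = if e then 1 else 2

-- Since (a^i b^j)(a^k b^l) = a^(i+k) b^((-1)^k j + l), whether a^i b^j and a^k b^l commute
-- only depends on the parities e, e′ of i, k and on j, l.
classCommute : Bool → Fin 3 → Bool → Fin 3 → Bool
classCommute e j e′ l = ⌊ (signᵇ e′ * toℕ j + toℕ l) mod 3 Fin.≟ (signᵇ e * toℕ l + toℕ j) mod 3 ⌋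

centralClass : Bool → Fin 3 → Bool
centralClass e j = e ∧ does (j Fin.≟ zero)

-- a^odd b^j lies in part j, and a^even b^(±1) in part 3.
classPart : Bool → Fin 3 → Fin 4
classPart e j = if e then fromℕ 3 else inject₁ j

by-table : (f g : Fin 3 → Fin 3 → Bool) → True (all? λ j → all? λ l → f j l ≟𝔹 g j l) → ∀ j l → f j l ≡ g j l
by-table f g = toWitness

classCommute-table : ∀ e e′ j l →
  classCommute e j e′ l ≡ (centralClass e j ∨ centralClass e′ l ∨ does (classPart e j Fin.≟ classPart e′ l))
classCommute-table e e′ = by-table _ (λ j l → centralClass e j ∨ centralClass e′ l ∨ does (classPart e j Fin.≟ classPart e′ l))
                                     (table e e′)
  where
  table : ∀ e e′ → True (all? λ j → all? λ l →
    classCommute e j e′ l ≟𝔹 (centralClass e j ∨ centralClass e′ l ∨ does (classPart e j Fin.≟ classPart e′ l)))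
  table true  true  = _
  table true  false = _
  table false true  = _
  table false false = _

classesIn : Fin 4 → ℕ
classesIn p = count (λ j → not (centralClass true j) ∧ does (classPart true j Fin.≟ p)) (allFin 3)
            + count (λ j → not (centralClass false j) ∧ does (classPart false j Fin.≟ p)) (allFin 3)

module U₆ₙ (n : ℕ) .{{_ : NonZero n}} where

  parity : Fin (2 * n) → Bool
  parity i = toℕ i % 2 ≡ᵇ 0

  centralᶜ : U n → Bool
  centralᶜ (i , j) = centralClass (parity i) j

  partOf : U n → Fin 4
  partOf (i , j) = classPart (parity i) j

  _≟U_ : DecidableEquality (U n)
  (i , j) ≟U (k , l) = map′ (λ (i≡k , j≡l) → cong₂ _,_ i≡k j≡l) (λ { refl → refl , refl }) (i Fin.≟ k ×-dec j Fin.≟ l)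

  T-eqU : ∀ {u v} → T (eqU n u v) ⇔ u ≡ v
  T-eqU {i , j} {k , l} rewrite isYes≗does (i Fin.≟ k) | isYes≗does (j Fin.≟ l) =
    mk⇔ (T-does⁻ ((i , j) ≟U (k , l))) (T-does⁺ ((i , j) ≟U (k , l)))

  commute≡ : ∀ g h → commute n g h ≡ (centralᶜ g ∨ centralᶜ h ∨ does (partOf g Fin.≟ partOf h))
  commute≡ (i , j) (k , l) =
    trans (⌊≟⌋-∧ (cong (λ t → (t mod (2 * n)) {{m*n≢0 2 n}}) (+-comm (toℕ i) (toℕ k))))
          (classCommute-table (parity i) (parity k) j l)

  private
    2≤2n : 2 ≤ 2 * n
    2≤2n = *-monoʳ-≤ 2 (>-nonZero⁻¹ n)

  even₀ : Fin (2 * n)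
  even₀ = fromℕ< (≤-trans (s≤s z≤n) 2≤2n)

  odd₁ : Fin (2 * n)
  odd₁ = fromℕ< 2≤2n

  parity-even₀ : parity even₀ ≡ true
  parity-even₀ rewrite toℕ-fromℕ< (≤-trans (s≤s z≤n) 2≤2n) = refl

  parity-odd₁ : parity odd₁ ≡ false
  parity-odd₁ rewrite toℕ-fromℕ< 2≤2n = refl

  away : ∀ g → ∃[ h ] centralᶜ h ≡ false × partOf g ≢ partOf h
  away g with partOf g Fin.≟ fromℕ 3
  ... | yes g∈3 = (odd₁ , zero) , cong (λ e → centralClass e zero) parity-odd₁ ,
                  λ g≡h → case trans (sym g∈3) (trans g≡h (cong (λ e → classPart e zero) parity-odd₁)) of λ ()
  ... | no  g∉3 = (even₀ , suc zero) , cong (λ e → centralClass e (suc zero)) parity-even₀ ,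
                  λ g≡h → g∉3 (trans g≡h (cong (λ e → classPart e (suc zero)) parity-even₀))

  ∈-elems : ∀ g → g ∈ elems n
  ∈-elems (i , j) = ∈-cartesianProduct⁺ (∈-allFin i) (∈-allFin j)

  central≡centralᶜ : ∀ g → central n g ≡ centralᶜ g
  central≡centralᶜ g with centralᶜ g in cg
  ... | true  = Equivalence.to T-≡ (all⁻ (commute n g) {xs = elems n} (All.tabulate λ {h} _ →
                  Equivalence.from T-≡ (trans (commute≡ g h) (cong (_∨ (centralᶜ h ∨ does (partOf g Fin.≟ partOf h))) cg))))
  ... | false with away g
  ...   | h , ch , g≢h = Equivalence.to T-not-≡ (T-not⁺ λ t →
            subst T (trans (commute≡ g h) noncommuting) (All.lookup (all⁺ (commute n g) (elems n) t) (∈-elems h)))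
    where
    noncommuting : (centralᶜ g ∨ centralᶜ h ∨ does (partOf g Fin.≟ partOf h)) ≡ false
    noncommuting rewrite cg | ch = dec-false (partOf g Fin.≟ partOf h) g≢h

  V : List (U n)
  V = vertices n

  private
    noncentral? : (g : U n) → Dec (not (central n g) ≡ true)
    noncentral? g = not (central n g) ≟𝔹 true

  ∈V⇔ : ∀ {g} → g ∈ V ⇔ centralᶜ g ≡ false
  ∈V⇔ {g} = mk⇔
    (λ g∈V → trans (sym (central≡centralᶜ g))
                   (Equivalence.to T-not-≡ (Equivalence.from T-≡ (proj₂ (∈-filter⁻ noncentral? {xs = elems n} g∈V)))))
    (λ cg → ∈-filter⁺ noncentral? (∈-elems g) (Equivalence.to T-≡ (Equivalence.from T-not-≡ (trans (central≡centralᶜ g) cg))))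

  unique-V : Unique V
  unique-V = filter⁺ noncentral? (cartesianProduct⁺ (allFin⁺ (2 * n)) (allFin⁺ 3))

  commute-V : ∀ {u w} → u ∈ V → w ∈ V → commute n u w ≡ does (partOf u Fin.≟ partOf w)
  commute-V {u} {w} u∈V w∈V rewrite commute≡ u w | Equivalence.to ∈V⇔ u∈V | Equivalence.to ∈V⇔ w∈V = refl

  count-elems : ∀ (H : Bool → Fin 3 → Bool) →
    count (λ g → H (parity (proj₁ g)) (proj₂ g)) (elems n) ≡ n * (count (H true) (allFin 3) + count (H false) (allFin 3))
  count-elems H = begin
    count (λ g → H (parity (proj₁ g)) (proj₂ g)) (elems n)
      ≡⟨ count-cartesianProduct _ (allFin (2 * n)) (allFin 3) ⟩
    sum (map (λ i → count (H (parity i)) (allFin 3)) (allFin (2 * n)))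
      ≡⟨ cong sum (map-tabulate id (λ i → count (H (parity i)) (allFin 3))) ⟩
    sum (tabulate (λ i → count (H (parity i)) (allFin 3)))
      ≡⟨ sum-tabulate-2-periodic n (λ k → count (H (k % 2 ≡ᵇ 0)) (allFin 3)) periodic ⟩
    n * (count (H true) (allFin 3) + count (H false) (allFin 3)) ∎
    where
    open ≡-Reasoning
    periodic : ∀ k → count (H ((2 + k) % 2 ≡ᵇ 0)) (allFin 3) ≡ count (H (k % 2 ≡ᵇ 0)) (allFin 3)
    periodic k = cong (λ r → count (H (r ≡ᵇ 0)) (allFin 3)) (trans (cong (_% 2) (+-comm 2 k)) ([m+n]%n≡m%n k 2))

  length-V : length V ≡ n * 5
  length-V = begin
    length V                                        ≡⟨ length-filter (not ∘ central n) (elems n) ⟩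
    count (not ∘ central n) (elems n)               ≡⟨ count-cong-∈ (elems n) (λ {g} _ → cong not (central≡centralᶜ g)) ⟩
    count (not ∘ centralᶜ) (elems n)                ≡⟨ count-elems (λ e j → not (centralClass e j)) ⟩
    n * 5                                           ∎
    where open ≡-Reasoning

  open Partition _≟U_ partOf using (size; missing; admissibleGF; admissibleGF-∏)
  open CompleteMultipartite _≟U_ partOf using (multipartiteDist; resolves⇔missing≤1)

  size-V : ∀ p → size V p ≡ n * classesIn p
  size-V p = begin
    count (λ g → H (parity (proj₁ g)) (proj₂ g)) V
      ≡⟨ count-filter (not ∘ central n) _ (elems n) ⟩
    count (λ g → not (central n g) ∧ H (parity (proj₁ g)) (proj₂ g)) (elems n)
      ≡⟨ count-cong-∈ (elems n) (λ {g} _ → cong (λ b → not b ∧ H (parity (proj₁ g)) (proj₂ g)) (central≡centralᶜ g)) ⟩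
    count (λ g → not (centralᶜ g) ∧ H (parity (proj₁ g)) (proj₂ g)) (elems n)
      ≡⟨ count-elems (λ e j → not (centralClass e j) ∧ H e j) ⟩
    n * classesIn p ∎
    where
    open ≡-Reasoning
    H : Bool → Fin 3 → Bool
    H e j = does (classPart e j Fin.≟ p)

  reach₀ : ∀ u w → reach n 0 u w ≡ does (u ≟U w)
  reach₀ u w = T-injective (mk⇔ (T-does⁺ (u ≟U w) ∘ Equivalence.to T-eqU) (Equivalence.from T-eqU ∘ T-does⁻ (u ≟U w)))

  adj-V : ∀ {u w} → u ∈ V → w ∈ V → adj n u w ≡ not (does (partOf u Fin.≟ partOf w))
  adj-V u∈V w∈V = cong not (commute-V u∈V w∈V)

  reach₁ : ∀ {u w} → u ∈ V → w ∈ V → reach n 1 u w ≡ does (u ≟U w) ∨ not (does (partOf u Fin.≟ partOf w))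
  reach₁ {u} {w} u∈V w∈V = cong₂ _∨_ (reach₀ u w) (trans one-step (adj-V u∈V w∈V))
    where
    one-step : any (λ y → reach n 0 u y ∧ adj n y w) V ≡ adj n u w
    one-step = T-injective (mk⇔
      (λ t → let (y , hy) = satisfied (Equivalence.from (any⇔ {xs = V} {p = λ y → reach n 0 u y ∧ adj n y w}) t)
                 (u≐y , adj-yw) = Equivalence.to T-∧ hy
             in subst (λ z → T (adj n z w)) (sym (Equivalence.to T-eqU u≐y)) adj-yw)
      (λ adj-uw → Equivalence.to (any⇔ {xs = V} {p = λ y → reach n 0 u y ∧ adj n y w})
                    (Any.map (λ { refl → Equivalence.from T-∧ (Equivalence.from (T-eqU {u} {u}) refl , adj-uw) }) u∈V)))

  reach₁-other : ∀ {u w} → u ∈ V → w ∈ V → partOf u ≢ partOf w → reach n 1 u w ≡ true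
  reach₁-other {u} {w} u∈V w∈V pu≢pw
    rewrite reach₁ u∈V w∈V | dec-false (partOf u Fin.≟ partOf w) pu≢pw = ∨-zeroʳ (does (u ≟U w))

  reach₂ : ∀ {u w} → u ∈ V → w ∈ V → reach n 2 u w ≡ true
  reach₂ {u} {w} u∈V w∈V with partOf u Fin.≟ partOf w
  ... | no pu≢pw  = cong (_∨ any (λ y → reach n 1 u y ∧ adj n y w) V) (reach₁-other u∈V w∈V pu≢pw)
  ... | yes pu≡pw = trans (cong (reach n 1 u w ∨_) via-away) (∨-zeroʳ (reach n 1 u w))
    where
    via-away : any (λ y → reach n 1 u y ∧ adj n y w) V ≡ true
    via-away with away u
    ... | y , cy , pu≢py = Equivalence.to T-≡ (Equivalence.to (any⇔ {xs = V} {p = λ y → reach n 1 u y ∧ adj n y w})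
            (Any.map (λ { refl → Equivalence.from T-∧
              ( Equivalence.from T-≡ (reach₁-other u∈V y∈V pu≢py)
              , Equivalence.from T-≡ (trans (adj-V y∈V w∈V)
                  (cong not (dec-false (partOf y Fin.≟ partOf w) λ py≡pw → pu≢py (trans pu≡pw (sym py≡pw)))))) }) y∈V))
      where y∈V = Equivalence.from (∈V⇔ {y}) cy

  private
    length-V-expanded : length V ≡ 5 + (n * 5 ∸ 5)
    length-V-expanded = trans length-V (sym (m+[n∸m]≡n (*-monoˡ-≤ 5 {1} {n} (>-nonZero⁻¹ n))))

    -- dist tries k = 0, 1, 2, … while k < |V|, and |V| ≥ 3 lets it reach k = 2.
    dist-≤2 : ∀ {u w} → reach n 2 u w ≡ true → dist n u w ≡ (if reach n 0 u w then 0 else if reach n 1 u w then 1 else 2)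
    dist-≤2 {u} {w} r₂ rewrite length-V-expanded with reach n 0 u w | reach n 1 u w | reach n 2 u w | r₂
    ... | true  | _     | _    | _ = refl
    ... | false | true  | _    | _ = refl
    ... | false | false | true | _ = refl

    multipartite-shape : ∀ e p → (if e then 0 else if e ∨ not p then 1 else 2) ≡ (if e then 0 else if p then 2 else 1)
    multipartite-shape true  _     = refl
    multipartite-shape false true  = refl
    multipartite-shape false false = refl

  dist-V : ∀ {u w} → u ∈ V → w ∈ V → dist n u w ≡ multipartiteDist u w
  dist-V {u} {w} u∈V w∈V = begin
    dist n u w
      ≡⟨ dist-≤2 (reach₂ u∈V w∈V) ⟩
    (if reach n 0 u w then 0 else if reach n 1 u w then 1 else 2)
      ≡⟨ cong₂ (λ r₀ r₁ → if r₀ then 0 else if r₁ then 1 else 2) (reach₀ u w) (reach₁ u∈V w∈V) ⟩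
    (if does (u ≟U w) then 0 else if does (u ≟U w) ∨ not (does (partOf u Fin.≟ partOf w)) then 1 else 2)
      ≡⟨ multipartite-shape (does (u ≟U w)) (does (partOf u Fin.≟ partOf w)) ⟩
    multipartiteDist u w ∎
    where open ≡-Reasoning

  module _ (2≤n : 2 ≤ n) where

    private
      4≤2n : 4 ≤ 2 * n
      4≤2n = *-monoʳ-≤ 2 2≤n

      odd₃ : Fin (2 * n)
      odd₃ = fromℕ< 4≤2n

    another-odd : ∀ i → ∃[ i′ ] parity i′ ≡ false × i′ ≢ i
    another-odd i with toℕ i ≟ 1
    ... | yes i≡1 = odd₃ , parity-odd₃ , λ { refl → case trans (sym (toℕ-fromℕ< 4≤2n)) i≡1 of λ () }
      where
      parity-odd₃ : parity odd₃ ≡ false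
      parity-odd₃ rewrite toℕ-fromℕ< 4≤2n = refl
    ... | no  i≢1 = odd₁ , parity-odd₁ , λ { refl → i≢1 (toℕ-fromℕ< 2≤2n) }

    partner : ∀ {u} → u ∈ V → ∃[ w ] w ∈ V × w ≢ u × partOf w ≡ partOf u
    partner {i , j} u∈V with parity i in pi | j
    ... | true  | zero           = contradiction (trans (sym (cong (λ e → centralClass e zero) pi)) (Equivalence.to ∈V⇔ u∈V)) λ ()
    ... | true  | suc zero       = (i , suc (suc zero)) , Equivalence.from ∈V⇔ (∧-zeroʳ (parity i)) , (λ ()) ,
                                   cong (λ e → classPart e (suc (suc zero))) pi
    ... | true  | suc (suc zero) = (i , suc zero) , Equivalence.from ∈V⇔ (∧-zeroʳ (parity i)) , (λ ()) ,
                                   cong (λ e → classPart e (suc zero)) pi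
    ... | false | j′ with another-odd i
    ...   | i′ , pi′ , i′≢i = (i′ , j′) , Equivalence.from ∈V⇔ (cong (λ e → centralClass e j′) pi′) , i′≢i ∘ cong proj₁ ,
                              cong (λ e → classPart e j′) pi′

    resolving≡admissible : ∀ W → (∀ {w} → w ∈ W → w ∈ V) → resolving n W ≡ does (missing V W ≤ᶠ? (λ _ → 1))
    resolving≡admissible W W⊆V = does-⇔
      (⇔.trans (T-resolvingᵇ (eqU n) T-eqU (dist n) V W)
               (resolves⇔missing≤1 (dist n) V unique-V dist-V partner W W⊆V))
      (T? (resolving n W)) (missing V W ≤ᶠ? (λ _ → 1))

    resolvingPoly≡∏ : ∀ x → resolvingPoly n x ≡ ∏ (λ p → missingAtMost x 1 (n * classesIn p))
    resolvingPoly≡∏ x = begin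
      resolvingPoly n x
        ≡⟨ sum-by-degree x length (resolving n) (length V) (sublists V) (All.tabulate (length-mono-≤ ∘ ∈-sublists⇒⊑ V)) ⟩
      sum (map (λ W → if resolving n W then x ^ length W else 0) (sublists V))
        ≡⟨ cong sum (map-cong-local (All.tabulate λ {W} W∈ →
             cong (λ b → if b then x ^ length W else 0) (resolving≡admissible W (⊑-lookup (∈-sublists⇒⊑ V W∈))))) ⟩
      admissibleGF x (λ _ → 1) V
        ≡⟨ admissibleGF-∏ x V unique-V (λ _ → 1) ⟩
      ∏ (λ p → missingAtMost x 1 (size V p))
        ≡⟨ ∏-cong (λ p → cong (missingAtMost x 1) (size-V p)) ⟩
      ∏ (λ p → missingAtMost x 1 (n * classesIn p)) ∎
      where open ≡-Reasoning

-- The resolving polynomial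

private
  5[2+m]∸4≡ : ∀ m → 5 * (2 + m) ∸ 4 ≡ suc m + (suc m + (suc m + (suc m + (2 + m + 0))))
  5[2+m]∸4≡ m = trans (cong (_∸ 4) (five-n m)) (m+n∸m≡n 4 _)
    where
    five-n : ∀ m → 5 * (2 + m) ≡ 4 + (suc m + (suc m + (suc m + (suc m + (2 + m + 0)))))
    five-n = solve-∀

  -- (y + k) ^ 3 is written out since the reflective solver does not unfold ℕ's _^_.
  regroup : ∀ y k a b → a * (y + k) * (a * (y + k) * (a * (y + k) * (b * (y + 2 * k) * 1)))
                        ≡ a * (a * (a * b)) * ((y + k) * ((y + k) * ((y + k) * 1))) * (y + 2 * k)
  regroup = solve-∀

-- The left-hand side is ∏ (λ p → missingAtMost x 1 (n * classesIn p)) evaluated: classesIn is 1, 1, 1, 2.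
closed-form : ∀ m x → let n = 2 + m in
  missingAtMost x 1 (n * 1) * (missingAtMost x 1 (n * 1) * (missingAtMost x 1 (n * 1) * (missingAtMost x 1 (n * 2) * 1)))
  ≡ x ^ (5 * n ∸ 4) * (x + n) ^ 3 * (x + 2 * n)
closed-form m x = begin
  M (n * 1) * (M (n * 1) * (M (n * 1) * (M (n * 2) * 1)))
    ≡⟨ cong₂ (λ a b → M a * (M a * (M a * (M b * 1)))) (*-identityʳ n) (*-comm n 2) ⟩
  M n * (M n * (M n * (M (2 * n) * 1)))
    ≡⟨ cong₂ (λ a b → a * (a * (a * (b * 1)))) (missingAtMost-1 x (suc m)) (missingAtMost-1 x t) ⟩
  p * (x + n) * (p * (x + n) * (p * (x + n) * (q * (x + 2 * n) * 1)))
    ≡⟨ regroup x n p q ⟩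
  p * (p * (p * q)) * (x + n) ^ 3 * (x + 2 * n)
    ≡⟨ cong (λ e → e * (x + n) ^ 3 * (x + 2 * n)) power ⟨
  x ^ (5 * n ∸ 4) * (x + n) ^ 3 * (x + 2 * n) ∎
  where
  open ≡-Reasoning
  n = 2 + m
  t = suc m + (n + 0)
  M = missingAtMost x 1
  p = x ^ suc m
  q = x ^ t
  power : x ^ (5 * n ∸ 4) ≡ p * (p * (p * q))
  power = begin
    x ^ (5 * n ∸ 4)                      ≡⟨ cong (x ^_) (5[2+m]∸4≡ m) ⟩
    x ^ (suc m + (suc m + (suc m + t)))  ≡⟨ ^-distribˡ-+-* x (suc m) _ ⟩
    p * x ^ (suc m + (suc m + t))        ≡⟨ cong (p *_) (^-distribˡ-+-* x (suc m) _) ⟩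
    p * (p * x ^ (suc m + t))            ≡⟨ cong (λ e → p * (p * e)) (^-distribˡ-+-* x (suc m) t) ⟩
    p * (p * (p * q))                    ∎

resolvingPoly-U₆ : ∀ x → resolvingPoly 1 x ≡ x ^ 3 * (x + 2) * (x + 3)
resolvingPoly-U₆ x = begin
  resolvingPoly 1 x
    ≡⟨⟩
  0 * x ^ 0 + (0 * x ^ 1 + (0 * x ^ 2 + (6 * x ^ 3 + (5 * x ^ 4 + (1 * x ^ 5 + 0)))))
    ≡⟨ solve 1 (λ x → con 0 :* x :^ 0 :+ (con 0 :* x :^ 1 :+ (con 0 :* x :^ 2 :+ (con 6 :* x :^ 3 :+ (con 5 :* x :^ 4 :+ (con 1 :* x :^ 5 :+ con 0)))))
                   := x :^ 3 :* (x :+ con 2) :* (x :+ con 3)) refl x ⟩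
  x ^ 3 * (x + 2) * (x + 3) ∎
  where
  open ≡-Reasoning
  open +-*-Solver

theorem3p3 : (n : ℕ) → .{{_ : NonZero n}} →
    ((n ≡ 1) → (x : ℕ) →
      resolvingPoly n x ≡ x ^ 3 * (x + 2) * (x + 3))
    × ((n > 1) → (x : ℕ) →
      resolvingPoly n x ≡ x ^ (5 * n ∸ 4) * (x + n) ^ 3 * (x + 2 * n))
theorem3p3 (suc zero)    = (λ _ → resolvingPoly-U₆) , λ { (s≤s ()) }
theorem3p3 (suc (suc m)) = (λ ()) , λ 1<n x → trans (U₆ₙ.resolvingPoly≡∏ (2 + m) 1<n x) (closed-form m x)
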